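{- Let $x$ be a string and let $\mathit{ST}(x)$ be its suffix tree. Then on any single edge of $\mathit{ST}(x)$ there are at most two implicit nodes $v$ such that $\mathit{str}(v)$ is a square.
   Context: The suffix tree $\mathit{ST}(x)$ of a string $x$ is the compacted trie of all non-empty suffixes of $x\$$, where $\$$ is a symbol not occurring in $x$: a rooted tree with edges labeled by non-empty strings, in which the concatenations of labels along root-to-leaf paths are exactly the suffixes of $x\$$, every non-leaf node has at least two children, and the edge labels to the children of a node begin with distinct letters. The nodes of this tree are explicit nodes; positions strictly inside edges (corresponding to proper non-empty prefixes of an edge label) are implicit nodes. For a (possibly implicit) node $v$, $\mathit{str}(v)$ is the concatenation of edge labels on the path from the root to $v$. A string is a square if it equals $ww$ for some string $w$. -}

module Defs where

open import Data.Nat using (ℕ; _≤_)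
open import Data.List using (List; []; _∷_; _++_; length; [_])
open import Data.Maybe using (Maybe; just; nothing)
open import Data.Product using (_×_; _,_; ∃)
open import Data.Sum using (_⊎_)
open import Data.List.Membership.Propositional using (_∈_)
open import Data.List.Relation.Unary.AllPairs using (AllPairs)
open import Relation.Binary.PropositionalEquality using (_≡_)
open import Relation.Nullary using (¬_)
open import Function.Bundles using (_⇔_)

data Tree (A : Set) : Set where
  node : List (List A × Tree A) → Tree A

module _ {A : Set} where

  headL : List A → Maybe A
  headL []      = nothing
  headL (a ∷ _) = just a

  data WF : Tree A → Set where
    wf : {cs : List (List A × Tree A)} →
         (∀ {l t} → (l , t) ∈ cs → ¬ (l ≡ []) × WF t) →
         (cs ≡ [] ⊎ 2 ≤ length cs) →
         AllPairs (λ c d → ¬ (headL (Data.Product.proj₁ c) ≡ headL (Data.Product.proj₁ d))) cs →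
         WF (node cs)

  data RootLeafPath : Tree A → List A → Set where
    leaf : RootLeafPath (node []) []
    step : {cs : List (List A × Tree A)} {l : List A} {t : Tree A} {s : List A} →
           (l , t) ∈ cs → RootLeafPath t s → RootLeafPath (node cs) (l ++ s)

  -- EdgeAt T p l : T has an edge labeled l whose upper endpoint u is an
  -- explicit node with str(u) = p.
  data EdgeAt : Tree A → List A → List A → Set where
    here  : {cs : List (List A × Tree A)} {l : List A} {t : Tree A} →
            (l , t) ∈ cs → EdgeAt (node cs) [] l
    there : {cs : List (List A × Tree A)} {l : List A} {t : Tree A} {p l′ : List A} →
            (l , t) ∈ cs → EdgeAt t p l′ → EdgeAt (node cs) (l ++ p) l′

  NonEmptySuffix : List A → List A → Set
  NonEmptySuffix s y = ¬ (s ≡ []) × ∃ (λ u → u ++ s ≡ y)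

  -- T is the suffix tree ST(x) of x, with terminator $ (assumed not in x):
  -- a compacted trie whose root-to-leaf path strings are exactly the
  -- non-empty suffixes of x$.
  IsSuffixTree : List A → A → Tree A → Set
  IsSuffixTree x $ T =
    WF T × (∀ s → RootLeafPath T s ⇔ NonEmptySuffix s (x ++ [ $ ]))

  IsSquare : List A → Set
  IsSquare s = ∃ (λ w → s ≡ w ++ w)

-- If u₁u₁, u₂u₂, u₃u₃ with |u₁| < |u₂| < |u₃| are prefixes of one another, then u₁u₁ occurs
-- again inside u₃u₃ at a shift d > 0: either |u₃| ≥ 2|u₁| and d = |u₃|, or the periods
-- |u₂| − |u₁| and |u₃| − |u₂| propagate along u₃u₃ and d is the smaller of them.
-- Now let s₁ ⊑ s₃ be the squares at implicit points of one edge. Every occurrence of s₁ in x$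
-- starts a suffix of x$, whose leaf path passes through s₁ and hence runs along the whole edge,
-- so it extends to an occurrence of s₃. Starting from any occurrence of s₃, the copy of s₁ at
-- shift d gives a later occurrence of s₃, and so on, which is impossible in a finite string.

module Submission where

open import Defs
open import Data.Nat using (ℕ; zero; suc; _+_; _⊓_; _≤_; _<_; _≤?_; _<?_; z<s; s≤s; s≤s⁻¹)
open import Data.Nat.Properties
open import Data.Nat.Induction using (<-rec)
open import Data.Nat.Tactic.RingSolver using (solve-∀)
open import Data.List using (List; []; _∷_; _++_; length; take; drop; [_])
open import Data.List.Properties
  using (length-++; length-take; take-take; take++drop≡id; ++-assoc; ++-identityʳ; ++-cancelˡ; ++-conicalˡ; ++-conicalʳ)
open import Data.List.Membership.Propositional using (_∈_; _∉_)
open import Data.List.Relation.Unary.Any using (here; there)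
open import Data.List.Relation.Unary.All using (lookup)
open import Data.List.Relation.Unary.AllPairs using (AllPairs; _∷_)
open import Data.Maybe using (Maybe; just; nothing)
open import Data.Empty using (⊥)
open import Data.Product using (_×_; _,_; proj₁; proj₂; ∃; ∃₂)
open import Data.Sum using ([_,_]′)
open import Function using (_∘_)
open import Function.Bundles using (Equivalence)
open import Relation.Nullary using (¬_; yes; no; contradiction)
open import Relation.Binary.PropositionalEquality hiding ([_])

module _ {A : Set} where

  infixl 5 _!_
  _!_ : List A → ℕ → Maybe A
  []       ! _     = nothing
  (x ∷ _)  ! zero  = just x
  (_ ∷ xs) ! suc i = xs ! i

  !-++ˡ : ∀ (xs ys : List A) {i} → i < length xs → (xs ++ ys) ! i ≡ xs ! i
  !-++ˡ (_ ∷ _)  ys {zero}  _   = refl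
  !-++ˡ (_ ∷ xs) ys {suc i} i<n = !-++ˡ xs ys (s≤s⁻¹ i<n)

  !-++ʳ : ∀ (xs ys : List A) i → (xs ++ ys) ! (length xs + i) ≡ ys ! i
  !-++ʳ []       ys i = refl
  !-++ʳ (_ ∷ xs) ys i = !-++ʳ xs ys i

  infix 4 _⊑_
  _⊑_ : List A → List A → Set
  s ⊑ W = ∃ λ r → W ≡ s ++ r

  Occurs : List A → List A → Set
  Occurs t y = ∃₂ λ A′ B → y ≡ A′ ++ t ++ B

  Occurs-⊑ : ∀ {s t y : List A} → s ⊑ t → Occurs t y → Occurs s y
  Occurs-⊑ {s} (r , refl) (A′ , B , refl) = A′ , r ++ B , cong (A′ ++_) (++-assoc s r B)

  OccursShiftedIn : List A → List A → Set
  OccursShiftedIn s t = ∃₂ λ α β → t ≡ α ++ s ++ β × 0 < length α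

  ⊑-trans : ∀ {s t W : List A} → s ⊑ t → t ⊑ W → s ⊑ W
  ⊑-trans {s} (r , refl) (r′ , refl) = r ++ r′ , ++-assoc s r r′

  ++⁺-⊑ : ∀ (u : List A) {s t} → s ⊑ t → u ++ s ⊑ u ++ t
  ++⁺-⊑ u {s} (r , refl) = r , sym (++-assoc u s r)

  length-++₃ : ∀ (r s t : List A) → length (r ++ s ++ t) ≡ length r + (length s + length t)
  length-++₃ r s t = trans (length-++ r) (cong (length r +_) (length-++ s))

  -- Positions past the end of W read as nothing, so n may exceed length W.
  record HasPeriod (W : List A) (d n : ℕ) : Set where
    constructor periodic
    field
      repeats : ∀ i → i + d < n → W ! i ≡ W ! (i + d)

  open HasPeriod public

  HasPeriod-≤ : ∀ {W d m n} → m ≤ n → HasPeriod W d n → HasPeriod W d m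
  HasPeriod-≤ m≤n P = periodic λ i i+d<m → repeats P i (<-≤-trans i+d<m m≤n)

  HasPeriod-difference : ∀ {W} p e n →
    HasPeriod W p (p + n) → HasPeriod W (p + e) (p + n) → HasPeriod W e n
  HasPeriod-difference {W} p e n Pp Pp+e = periodic repeats-e
    where
    open ≡-Reasoning
    repeats-e : ∀ i → i + e < n → W ! i ≡ W ! (i + e)
    repeats-e i i+e<n = begin
      W ! i             ≡⟨ repeats Pp+e i (subst (_< p + n) (sym shift) i+e+p<p+n) ⟩
      W ! (i + (p + e)) ≡⟨ cong (W !_) shift ⟩
      W ! (i + e + p)   ≡⟨ repeats Pp (i + e) i+e+p<p+n ⟨
      W ! (i + e)       ∎
      where
      shift : i + (p + e) ≡ i + e + p
      shift = trans (cong (i +_) (+-comm p e)) (sym (+-assoc i e p))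
      i+e+p<p+n : i + e + p < p + n
      i+e+p<p+n = subst (i + e + p <_) (+-comm n p) (+-monoˡ-< p i+e<n)

  -- Beyond k, the period f moves each position back to a smaller one; hence recursion on i.
  HasPeriod-extend : ∀ {W} f d k m → 0 < f → f + d ≤ k →
    HasPeriod W f m → HasPeriod W d k → HasPeriod W d m
  HasPeriod-extend {W} f d k m 0<f f+d≤k Pf Pd = periodic (<-rec Goal repeats-from)
    where
    open ≡-Reasoning
    Goal : ℕ → Set
    Goal i = i + d < m → W ! i ≡ W ! (i + d)
    repeats-from : ∀ i → (∀ {j} → j < i → Goal j) → Goal i
    repeats-from i rec i+d<m with i + d <? k
    ... | yes i+d<k = repeats Pd i i+d<k
    ... | no i+d≮k with m≤n⇒∃[o]m+o≡n (+-cancelʳ-≤ d f i (≤-trans f+d≤k (≮⇒≥ i+d≮k)))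
    ... | o , refl = begin
      W ! (f + o)     ≡⟨ cong (W !_) (+-comm f o) ⟩
      W ! (o + f)     ≡⟨ repeats Pf o (subst (_< m) (+-comm f o) (≤-<-trans (m≤m+n (f + o) d) i+d<m)) ⟨
      W ! o           ≡⟨ rec (m<n+m o 0<f) (≤-<-trans (+-monoˡ-≤ d (m≤n+m o f)) i+d<m) ⟩
      W ! (o + d)     ≡⟨ repeats Pf (o + d) (subst (_< m) rotate i+d<m) ⟩
      W ! (o + d + f) ≡⟨ cong (W !_) rotate ⟨
      W ! (f + o + d) ∎
      where
      rotate : f + o + d ≡ o + d + f
      rotate = trans (+-assoc f o d) (+-comm f (o + d))

  private
    twice-mono-≤ : ∀ {m n} → m ≤ n → m + m ≤ n + n
    twice-mono-≤ m≤n = +-mono-≤ m≤n m≤n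

    twice-+ : ∀ a e → a + a + (e + e) ≡ (a + e) + (a + e)
    twice-+ = solve-∀

  -- For b = a + e and c = b + f with e + f ≤ a, the shift d = min e f works.
  close-square-prefixes-period : ∀ {W} a e f → 0 < e → 0 < f → e + f ≤ a →
    HasPeriod W a (a + a) → HasPeriod W (a + e) ((a + e) + (a + e)) →
    HasPeriod W (a + e + f) ((a + e + f) + (a + e + f)) →
    ∃ λ d → 0 < d × a + a + d ≤ (a + e) + (a + e) × HasPeriod W d (a + a + d)
  close-square-prefixes-period {W} a e f 0<e 0<f e+f≤a Pa Pb Pc =
    [ (λ e≤f → shifted e 0<e ≤-refl (≤-trans (+-monoʳ-≤ e e≤f) e+f≤a) Pe-on-b)
    , (λ f≤e → shifted f 0<f f≤e e+f≤a Pf)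
    ]′ (≤-total e f)
    where
    Pf : HasPeriod W f (a + e)
    Pf = HasPeriod-difference (a + e) f (a + e) Pb
           (HasPeriod-≤ (twice-mono-≤ (m≤m+n (a + e) f)) Pc)

    Pe-on-b : HasPeriod W e (a + e)
    Pe-on-b = HasPeriod-extend f e a (a + e) 0<f (subst (_≤ a) (+-comm e f) e+f≤a) Pf
      (HasPeriod-difference a e a Pa (HasPeriod-≤ (twice-mono-≤ (m≤m+n a e)) Pb))

    0<a : 0 < a
    0<a = <-≤-trans 0<e (m+n≤o⇒m≤o e e+f≤a)

    shifted : ∀ d → 0 < d → d ≤ e → e + d ≤ a → HasPeriod W d (a + e) →
      ∃ λ d → 0 < d × a + a + d ≤ (a + e) + (a + e) × HasPeriod W d (a + a + d)
    shifted d 0<d d≤e e+d≤a Pd = d , 0<d , bound , HasPeriod-≤ bound on-2b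
      where
      bound : a + a + d ≤ (a + e) + (a + e)
      bound = subst (a + a + d ≤_) (twice-+ a e) (+-monoʳ-≤ (a + a) (≤-trans d≤e (m≤m+n e e)))
      on-2a : HasPeriod W d (a + a)
      on-2a = HasPeriod-extend a d (a + e) (a + a) 0<a (+-monoʳ-≤ a d≤e) Pa Pd
      on-2b : HasPeriod W d ((a + e) + (a + e))
      on-2b = HasPeriod-extend (a + e) d (a + a) ((a + e) + (a + e)) (<-≤-trans 0<a (m≤m+n a e))
                (subst (_≤ a + a) (sym (+-assoc a e d)) (+-monoʳ-≤ a e+d≤a)) Pb on-2a

  private
    positive-gap : ∀ {m n} → m < m + n → 0 < n
    positive-gap {m} {zero}  m<m+0 = contradiction m<m+0 (<-irrefl (sym (+-identityʳ m)))
    positive-gap {n = suc n} _     = z<s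

  three-square-prefixes-period : ∀ {W a b c} → 0 < a → a < b → b < c →
    HasPeriod W a (a + a) → HasPeriod W b (b + b) → HasPeriod W c (c + c) →
    ∃ λ d → 0 < d × a + a + d ≤ c + c × HasPeriod W d (a + a + d)
  three-square-prefixes-period {a = a} {c = c} 0<a a<b b<c Pa Pb Pc with a + a ≤? c
  ... | yes 2a≤c = c , <-trans (<-trans 0<a a<b) b<c , +-monoˡ-≤ c 2a≤c , HasPeriod-≤ (+-monoˡ-≤ c 2a≤c) Pc
  ... | no 2a≰c with m≤n⇒∃[o]m+o≡n (<⇒≤ a<b)
  ... | e , refl with m≤n⇒∃[o]m+o≡n (<⇒≤ b<c)
  ... | f , refl with close-square-prefixes-period a e f (positive-gap a<b) (positive-gap b<c) e+f≤a Pa Pb Pc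
    where
    e+f≤a : e + f ≤ a
    e+f≤a = <⇒≤ (+-cancelˡ-< a (e + f) a (subst (_< a + a) (+-assoc a e f) (≰⇒> 2a≰c)))
  ... | d , 0<d , bound , Pd = d , 0<d , ≤-trans bound (twice-mono-≤ (<⇒≤ b<c)) , Pd

  square-prefix-period : ∀ {W} (u : List A) → u ++ u ⊑ W →
    HasPeriod W (length u) (length u + length u)
  square-prefix-period u (r , refl) = periodic repeats-u
    where
    open ≡-Reasoning
    in-uu : ∀ {i} → i < length u + length u → i < length (u ++ u)
    in-uu = subst (_ <_) (sym (length-++ u))
    repeats-u : ∀ i → i + length u < length u + length u →
      ((u ++ u) ++ r) ! i ≡ ((u ++ u) ++ r) ! (i + length u)
    repeats-u i i+a<2a = begin
      ((u ++ u) ++ r) ! i              ≡⟨ !-++ˡ (u ++ u) r (in-uu (≤-trans i<a (m≤m+n _ _))) ⟩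
      (u ++ u) ! i                     ≡⟨ !-++ˡ u u i<a ⟩
      u ! i                            ≡⟨ !-++ʳ u u i ⟨
      (u ++ u) ! (length u + i)        ≡⟨ cong ((u ++ u) !_) (+-comm (length u) i) ⟩
      (u ++ u) ! (i + length u)        ≡⟨ !-++ˡ (u ++ u) r (in-uu i+a<2a) ⟨
      ((u ++ u) ++ r) ! (i + length u) ∎
      where
      i<a : i < length u
      i<a = +-cancelʳ-< (length u) i (length u) i+a<2a

  pointwise⇒⊑ : ∀ (s W : List A) → length s ≤ length W →
    (∀ i → i < length s → W ! i ≡ s ! i) → s ⊑ W
  pointwise⇒⊑ []      W       _       _     = W , refl
  pointwise⇒⊑ (_ ∷ s) (_ ∷ W) |s|≤|W| agree
    with agree 0 z<s | pointwise⇒⊑ s W (s≤s⁻¹ |s|≤|W|) (λ i → agree (suc i) ∘ s≤s)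
  ... | refl | r , refl = r , refl

  pointwise⇒occurs-at : ∀ d (s W : List A) → d + length s ≤ length W →
    (∀ i → i < length s → W ! (d + i) ≡ s ! i) →
    ∃₂ λ α β → W ≡ α ++ s ++ β × length α ≡ d
  pointwise⇒occurs-at zero s W le agree with pointwise⇒⊑ s W le agree
  ... | β , refl = [] , β , refl , refl
  pointwise⇒occurs-at (suc d) s (w ∷ W) le agree with pointwise⇒occurs-at d s W (s≤s⁻¹ le) agree
  ... | α , β , refl , refl = w ∷ α , β , refl , refl

  period-shifts-prefix : ∀ {W d} (s : List A) → s ⊑ W → d + length s ≤ length W →
    HasPeriod W d (length s + d) → ∃₂ λ α β → W ≡ α ++ s ++ β × length α ≡ d
  period-shifts-prefix {d = d} s (r , refl) le P = pointwise⇒occurs-at d s (s ++ r) le λ i i<|s| →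
    begin
      (s ++ r) ! (d + i) ≡⟨ cong ((s ++ r) !_) (+-comm d i) ⟩
      (s ++ r) ! (i + d) ≡⟨ repeats P i (+-monoˡ-< d i<|s|) ⟨
      (s ++ r) ! i       ≡⟨ !-++ˡ s r i<|s| ⟩
      s ! i              ∎
    where open ≡-Reasoning

  private
    half-< : ∀ {m n} → m + m < n + n → m < n
    half-< {m} {n} 2m<2n with m <? n
    ... | yes m<n = m<n
    ... | no m≮n  = contradiction (twice-mono-≤ (≮⇒≥ m≮n)) (<⇒≱ 2m<2n)

    square-length-< : ∀ (u v : List A) → length (u ++ u) < length (v ++ v) → length u < length v
    square-length-< u v = half-< ∘ subst₂ _<_ (length-++ u) (length-++ v)

  nested-square-prefixes-overlap : ∀ {s₁ s₂ s₃ : List A} → IsSquare s₁ → IsSquare s₂ → IsSquare s₃ →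
    0 < length s₁ → length s₁ < length s₂ → length s₂ < length s₃ → s₁ ⊑ s₃ → s₂ ⊑ s₃ →
    OccursShiftedIn s₁ s₃
  nested-square-prefixes-overlap (u₁ , refl) (u₂ , refl) (u₃ , refl) 0<|s₁| |s₁|<|s₂| |s₂|<|s₃| s₁⊑s₃ s₂⊑s₃
    with three-square-prefixes-period
           (square-length-< [] u₁ 0<|s₁|) (square-length-< u₁ u₂ |s₁|<|s₂|) (square-length-< u₂ u₃ |s₂|<|s₃|)
           (square-prefix-period u₁ s₁⊑s₃) (square-prefix-period u₂ s₂⊑s₃)
           (square-prefix-period u₃ ([] , sym (++-identityʳ _)))
  ... | d , 0<d , 2a+d≤2c , Pd
    with period-shifts-prefix (u₁ ++ u₁) s₁⊑s₃
           (subst₂ _≤_ (trans (+-comm _ d) (cong (d +_) (sym (length-++ u₁)))) (sym (length-++ u₃)) 2a+d≤2c)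
           (subst (λ n → HasPeriod _ d (n + d)) (sym (length-++ u₁)) Pd)
  ... | α , β , s₃≡αs₁β , refl = α , β , s₃≡αs₁β , 0<d

  AlwaysExtendsTo : List A → List A → List A → Set
  AlwaysExtendsTo y s t = ∀ A′ B → y ≡ A′ ++ s ++ B → t ⊑ s ++ B

  AlwaysExtendsTo-⊑ : ∀ {y s t t′ : List A} → AlwaysExtendsTo y s t → t′ ⊑ t → AlwaysExtendsTo y s t′
  AlwaysExtendsTo-⊑ extends t′⊑t A′ B y≡ = ⊑-trans t′⊑t (extends A′ B y≡)

  -- The copy of s inside t extends to a later occurrence of t, with a strictly shorter remainder B.
  self-overlapping-extension-never-occurs : ∀ {y s t : List A} →
    AlwaysExtendsTo y s t → OccursShiftedIn s t → ¬ Occurs t y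
  self-overlapping-extension-never-occurs {y} {s} extends (α , β , refl , 0<|α|) (A′ , B , y≡) =
    no-occurrence-before (suc (length B)) A′ B ≤-refl y≡
    where
    open ≡-Reasoning
    t : List A
    t = α ++ s ++ β

    shorter : ∀ B C → s ++ β ++ B ≡ t ++ C → length C < length B
    shorter B C eq = subst (length C <_) (sym |B|≡|α|+|C|) (m<n+m (length C) 0<|α|)
      where
      |B|≡|α|+|C| : length B ≡ length α + length C
      |B|≡|α|+|C| = +-cancelˡ-≡ (length s + length β) _ _ (begin
        length s + length β + length B               ≡⟨ +-assoc (length s) (length β) (length B) ⟩
        length s + (length β + length B)             ≡⟨ length-++₃ s β B ⟨
        length (s ++ β ++ B)                         ≡⟨ cong length eq ⟩
        length (t ++ C)                              ≡⟨ length-++ t ⟩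
        length t + length C                          ≡⟨ cong (_+ length C) (length-++₃ α s β) ⟩
        length α + (length s + length β) + length C  ≡⟨ rearrange (length α) (length s + length β) (length C) ⟩
        length s + length β + (length α + length C)  ∎)
        where
        rearrange : ∀ a m c → a + m + c ≡ m + (a + c)
        rearrange = solve-∀

    regroup : ∀ A′ B → A′ ++ t ++ B ≡ (A′ ++ α) ++ s ++ β ++ B
    regroup A′ B = begin
      A′ ++ (α ++ s ++ β) ++ B  ≡⟨ cong (A′ ++_) (trans (++-assoc α (s ++ β) B) (cong (α ++_) (++-assoc s β B))) ⟩
      A′ ++ α ++ s ++ β ++ B    ≡⟨ ++-assoc A′ α (s ++ β ++ B) ⟨
      (A′ ++ α) ++ s ++ β ++ B  ∎

    no-occurrence-before : ∀ n A′ B → length B < n → y ≡ A′ ++ t ++ B → ⊥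
    no-occurrence-before (suc n) A′ B |B|<1+n y≡
      with extends (A′ ++ α) (β ++ B) (trans y≡ (regroup A′ B))
    ... | C , sβB≡tC = no-occurrence-before n (A′ ++ α) C
          (<-≤-trans (shorter B C sβB≡tC) (s≤s⁻¹ |B|<1+n))
          (trans y≡ (trans (regroup A′ B) (cong ((A′ ++ α) ++_) sβB≡tC)))

  unique-child : ∀ {cs : List (List A × Tree A)} {c d} →
    AllPairs (λ c d → ¬ (headL (proj₁ c) ≡ headL (proj₁ d))) cs →
    c ∈ cs → d ∈ cs → headL (proj₁ c) ≡ headL (proj₁ d) → c ≡ d
  unique-child _              (here refl) (here refl) _  = refl
  unique-child (distinct ∷ _) (here refl) (there d∈)  eq = contradiction eq (lookup distinct d∈)
  unique-child (distinct ∷ _) (there c∈)  (here refl) eq = contradiction (sym eq) (lookup distinct c∈)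
  unique-child (_ ∷ pairs)    (there c∈)  (there d∈)  eq = unique-child pairs c∈ d∈ eq

  headL-++ : ∀ {l : List A} s → ¬ l ≡ [] → headL (l ++ s) ≡ headL l
  headL-++ {[]}    _ l≢[] = contradiction refl l≢[]
  headL-++ {_ ∷ _} _ _    = refl

  some-RootLeafPath : (t : Tree A) → ∃ (RootLeafPath t)
  some-RootLeafPath (node [])             = [] , leaf
  some-RootLeafPath (node ((l , t) ∷ _)) with some-RootLeafPath t
  ... | s , path = l ++ s , step (here refl) path

  EdgeAt⇒RootLeafPath : ∀ {T : Tree A} {p l} → EdgeAt T p l → ∃ λ r → RootLeafPath T (p ++ l ++ r)
  EdgeAt⇒RootLeafPath (here {t = t} l∈) with some-RootLeafPath t
  ... | s , path = s , step l∈ path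
  EdgeAt⇒RootLeafPath (there {l = l₀} {p = p₀} {l′ = l} l₀∈ e) with EdgeAt⇒RootLeafPath e
  ... | r , path = r , subst (RootLeafPath _) (sym (++-assoc l₀ p₀ (l ++ r))) (step l₀∈ path)

  -- Children are told apart by their first letter, so a path through a point inside an edge follows it.
  RootLeafPath-follows-edge : ∀ {T : Tree A} {p l q q′ r s : List A} → WF T → EdgeAt T p l → ¬ q ≡ [] → l ≡ q ++ q′ →
    RootLeafPath T s → s ≡ p ++ q ++ r → p ++ l ⊑ s
  RootLeafPath-follows-edge {q = q} {q′} {r} (wf children _ distinct) (here l∈) q≢[] refl
    (step {l = l′} {s = s′} l′∈ _) s≡ with unique-child distinct l′∈ l∈ same-head
    where
    open ≡-Reasoning
    same-head : headL l′ ≡ headL (q ++ q′)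
    same-head = begin
      headL l′         ≡⟨ headL-++ s′ (proj₁ (children l′∈)) ⟨
      headL (l′ ++ s′) ≡⟨ cong headL s≡ ⟩
      headL (q ++ r)   ≡⟨ headL-++ r q≢[] ⟩
      headL q          ≡⟨ headL-++ q′ q≢[] ⟨
      headL (q ++ q′)  ∎
  ... | refl = s′ , refl
  RootLeafPath-follows-edge {l = l} {q} {q′} {r} (wf children _ distinct) (there {l = l₀} {p = p₀} l₀∈ e) q≢[] l≡
    (step {l = l′} {s = s′} l′∈ path) s≡ with unique-child distinct l′∈ l₀∈ same-head
    where
    open ≡-Reasoning
    same-head : headL l′ ≡ headL l₀
    same-head = begin
      headL l′                         ≡⟨ headL-++ s′ (proj₁ (children l′∈)) ⟨
      headL (l′ ++ s′)                 ≡⟨ cong headL (trans s≡ (++-assoc l₀ p₀ (q ++ r))) ⟩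
      headL (l₀ ++ p₀ ++ q ++ r)       ≡⟨ headL-++ (p₀ ++ q ++ r) (proj₁ (children l₀∈)) ⟩
      headL l₀                         ∎
  ... | refl = subst (_⊑ l₀ ++ s′) (sym (++-assoc l₀ p₀ l))
                 (++⁺-⊑ l₀ (RootLeafPath-follows-edge (proj₂ (children l₀∈)) e q≢[] l≡ path
                   (++-cancelˡ l₀ _ _ (trans s≡ (++-assoc l₀ p₀ (q ++ r))))))

  IsSuffixTree⇒edge-occurs : ∀ {x $ T} {p l : List A} → IsSuffixTree x $ T → EdgeAt T p l →
    Occurs (p ++ l) (x ++ [ $ ])
  IsSuffixTree⇒edge-occurs {p = p} {l} (_ , suffixes) e with EdgeAt⇒RootLeafPath e
  ... | r , path with Equivalence.to (suffixes _) path
  ... | _ , U , U++plr≡y = U , r , trans (sym U++plr≡y) (cong (U ++_) (sym (++-assoc p l r)))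

  IsSuffixTree⇒edge-point-extends : ∀ {x $ T} {p l q : List A} → IsSuffixTree x $ T → EdgeAt T p l →
    ¬ q ≡ [] → q ⊑ l → AlwaysExtendsTo (x ++ [ $ ]) (p ++ q) (p ++ l)
  IsSuffixTree⇒edge-point-extends {p = p} {q = q} (wfT , suffixes) e q≢[] (q′ , l≡) A′ B y≡ =
    RootLeafPath-follows-edge wfT e q≢[] l≡ path (++-assoc p q B)
    where
    nonempty : ¬ (p ++ q) ++ B ≡ []
    nonempty pqB≡[] = q≢[] (++-conicalʳ p q (++-conicalˡ (p ++ q) B pqB≡[]))
    path : RootLeafPath _ ((p ++ q) ++ B)
    path = Equivalence.from (suffixes _) (nonempty , A′ , sym y≡)

  take-⊑ : ∀ k (l : List A) → take k l ⊑ l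
  take-⊑ k l = drop k l , sym (take++drop≡id k l)

  take-⊑-take : ∀ {k k′} (l : List A) → k ≤ k′ → take k l ⊑ take k′ l
  take-⊑-take {k} {k′} l k≤k′ = drop k (take k′ l) , (begin
    take k′ l                                  ≡⟨ take++drop≡id k (take k′ l) ⟨
    take k (take k′ l) ++ drop k (take k′ l)   ≡⟨ cong (_++ drop k (take k′ l)) (take-take k k′ l) ⟩
    take (k ⊓ k′) l ++ drop k (take k′ l)      ≡⟨ cong (λ n → take n l ++ drop k (take k′ l)) (m≤n⇒m⊓n≡m k≤k′) ⟩
    take k l ++ drop k (take k′ l)             ∎)
    where open ≡-Reasoning

  take-≢[] : ∀ {k} (l : List A) → 0 < k → k ≤ length l → ¬ take k l ≡ []
  take-≢[] []      (s≤s _) ()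
  take-≢[] (_ ∷ _) (s≤s _) _ ()

  length-++-take : ∀ (p l : List A) {k} → k ≤ length l → length (p ++ take k l) ≡ length p + k
  length-++-take p l {k} k≤|l| = trans (length-++ p) (cong (length p +_) (trans (length-take k l) (m≤n⇒m⊓n≡m k≤|l|)))

  length-++-take-< : ∀ (p l : List A) {k k′} → k < k′ → k′ ≤ length l →
    length (p ++ take k l) < length (p ++ take k′ l)
  length-++-take-< p l k<k′ k′≤|l| =
    subst₂ _<_ (sym (length-++-take p l (≤-trans (<⇒≤ k<k′) k′≤|l|))) (sym (length-++-take p l k′≤|l|))
      (+-monoʳ-< (length p) k<k′)

corollary1 : {A : Set} (x : List A) ($ : A) → $ ∉ x →
    (T : Tree A) → IsSuffixTree x $ T →
    {p l : List A} → EdgeAt T p l →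
    (k₁ k₂ k₃ : ℕ) → 0 < k₁ → k₁ < k₂ → k₂ < k₃ → k₃ < length l →
    IsSquare (p ++ take k₁ l) → IsSquare (p ++ take k₂ l) →
    IsSquare (p ++ take k₃ l) → ⊥
corollary1 x $ _ T suffix-tree {p} {l} e k₁ k₂ k₃ 0<k₁ k₁<k₂ k₂<k₃ k₃<|l| sq₁ sq₂ sq₃ =
  self-overlapping-extension-never-occurs
    (AlwaysExtendsTo-⊑
      (IsSuffixTree⇒edge-point-extends suffix-tree e (take-≢[] l 0<k₁ k₁≤|l|) (take-⊑ k₁ l))
      s₃⊑edge)
    (nested-square-prefixes-overlap sq₁ sq₂ sq₃
      (subst (0 <_) (sym (length-++-take p l k₁≤|l|)) (<-≤-trans 0<k₁ (m≤n+m k₁ (length p))))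
      (length-++-take-< p l k₁<k₂ k₂≤|l|) (length-++-take-< p l k₂<k₃ k₃≤|l|)
      (++⁺-⊑ p (take-⊑-take l k₁≤k₃)) (++⁺-⊑ p (take-⊑-take l (<⇒≤ k₂<k₃))))
    (Occurs-⊑ s₃⊑edge (IsSuffixTree⇒edge-occurs suffix-tree e))
  where
  k₃≤|l| : k₃ ≤ length l
  k₃≤|l| = <⇒≤ k₃<|l|
  k₂≤|l| : k₂ ≤ length l
  k₂≤|l| = ≤-trans (<⇒≤ k₂<k₃) k₃≤|l|
  k₁≤k₃ : k₁ ≤ k₃
  k₁≤k₃ = <⇒≤ (<-trans k₁<k₂ k₂<k₃)
  k₁≤|l| : k₁ ≤ length l
  k₁≤|l| = ≤-trans k₁≤k₃ k₃≤|l|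
  s₃⊑edge : p ++ take k₃ l ⊑ p ++ l
  s₃⊑edge = ++⁺-⊑ p (take-⊑ k₃ l)
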